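{- (Progress) Let $\Sigma$ be a signature and $V$ a set of process definitions over $\Sigma$. If $\bar x:\omega\Vdash\mathcal C::(y:A)$, then either $\mathcal C$ can make a transition, or $\mathcal C=(\cdot)$ is empty, or $\mathcal C$ attempts to communicate either to the left or to the right.
   Context: Signature $\Sigma$: finite set of type definitions $t=^i_aA$ with polarity $a\in\{\mu,\nu\}$ and priority $i$; types $A::=\oplus\{\ell:A_\ell\}_{\ell\in L}\mid\&\{\ell:A_\ell\}_{\ell\in L}\mid1\mid t$. Processes: $P::=y\leftarrow x\mid(x\leftarrow P_x;Q_x)\mid Rx.k;P\mid\mathbf{case}\,Lx(\ell\Rightarrow Q_\ell)\mid\mathbf{case}\,Rx(\ell\Rightarrow P_\ell)\mid Lx.k;P\mid\mathbf{close}\,Rx\mid\mathbf{wait}\,Lx;Q\mid Rx.\mu_t;P\mid\mathbf{case}\,Lx(\mu_t\Rightarrow P)\mid\mathbf{case}\,Rx(\nu_t\Rightarrow P)\mid Lx.\nu_t;P\mid y\leftarrow X\leftarrow\bar x$; definitions $\bar u:\omega\vdash X=P_{\bar u,w}::(w:C)\in V$. Process typing $\bar x:\omega\vdash P::(y:C)$ ($\omega$ empty iff $\bar x$ empty) by the standard rules of subsingleton logic with fixed points: Id, Cut, $\oplus R$ ($Ry.k;P$), $\oplus L$ ($\mathbf{case}\,Lx$), $\&R$ ($\mathbf{case}\,Ry$), $\&L$ ($Lx.k;P$), $1R$ ($\cdot\vdash\mathbf{close}\,Ry::(y:1)$), $1L$ ($\mathbf{wait}\,Lx;Q$ from $\cdot\vdash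 Q$), $\mu R$ ($Ry.\mu_t;P::(y:t)$ from $P::(y:A)$, $t=_\mu A$), $\mu L$ ($x:t\vdash\mathbf{case}\,Lx(\mu_t\Rightarrow Q)$ from $x:A\vdash Q$), $\nu R$ ($\mathbf{case}\,Ry(\nu_t\Rightarrow P)::(y:t)$ from $P::(y:A)$, $t=_\nu A$), $\nu L$ ($x:t\vdash Lx.\nu_t;Q$ from $x:A\vdash Q$), Def (a call is typed by the type of $X$'s definition, whose body is typed, possibly by an infinite derivation). Configurations $\mathcal C::=\cdot\mid P\mid\mathcal C_1\mid_x\mathcal C_2$, typed by: $x:A\Vdash\cdot::(x:A)$; $\bar x:\omega\Vdash P::(y:B)$ if $\bar x:\omega\vdash P::(y:B)$; $\bar x:\omega\Vdash\mathcal C_1\mid_z\mathcal C_2::(y:B)$ if $\bar x:\omega\Vdash\mathcal C_1::(z:A)$ and $z:A\Vdash\mathcal C_2::(y:B)$. Transitions (anywhere, $z$ fresh): forward $P_x\mid_x(y\leftarrow x)\mid_yQ_y\mapsto P_z\mid_zQ_z$; spawn $(x\leftarrow P_x;Q_x)\mapsto P_z\mid_zQ_z$; $(Rx.k;P)\mid_x\mathbf{case}\,Lx(\ell\Rightarrow Q_\ell)\mapsto P\mid_xQ_k$; $\mathbf{case}\,Rx(\ell\Rightarrow P_\ell)\mid_x(Lx.k;Q)\mapsto P_k\mid_xQ$; $\mathbf{close}\,Rx\mid_x(\mathbf{wait}\,Lx;Q)\mapsto Q$; $(Rx.\mu_t;P)\mid_x\mathbf{case}\,Lx(\mu_t\Rightarrow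 Q)\mapsto P\mid_xQ$; $\mathbf{case}\,Rx(\nu_t\Rightarrow P)\mid_x(Lx.\nu_t;Q)\mapsto P\mid_xQ$; call unfolding $y\leftarrow X\leftarrow\bar x\mapsto P_{\bar x,y}$. A configuration attempts to communicate to the left (right) if some process in it is ready to perform its next action (send, receive, close, wait) on the configuration's external left channel $\bar x$ (right channel $y$). -}

module Defs where

open import Data.Nat using (ℕ)
open import Data.Fin using (Fin)
open import Data.Maybe using (Maybe; just; nothing)
open import Data.List using (List; []; _∷_; _++_)
open import Data.Product using (Σ; ∃; ∃-syntax; _×_; _,_)
open import Relation.Binary.PropositionalEquality using (_≡_)

-- Types over a signature with ns type names (names are Fin ns).
-- A label set L is represented as Fin m (labels are its elements).

data Tp (ns : ℕ) : Set where
  ⊕⟨_⟩ : {m : ℕ} → (Fin m → Tp ns) → Tp ns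
  &⟨_⟩ : {m : ℕ} → (Fin m → Tp ns) → Tp ns
  𝟙    : Tp ns
  tvar : Fin ns → Tp ns

data Polarity : Set where
  μ ν : Polarity

-- A signature: every type name t has exactly one definition t =^i_a A.
record Signature (ns : ℕ) : Set where
  field
    pol  : Fin ns → Polarity
    pri  : Fin ns → ℕ
    body : Fin ns → Tp ns
open Signature public

-- Antecedent ω: empty (nothing) or a single type (just A).
Ctx : ℕ → Set
Ctx ns = Maybe (Tp ns)

-- Processes (nameless/positional: a process has at most one left
-- channel and exactly one right channel, so "Lx" / "Ry" are determined
-- by the side; nd = number of process definitions in V).

data Proc (ns nd : ℕ) : Set where
  fwd     : Proc ns nd
  cut     : Proc ns nd → Proc ns nd → Proc ns nd
  sendR   : {m : ℕ} → Fin m → Proc ns nd → Proc ns nd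
  caseL   : {m : ℕ} → (Fin m → Proc ns nd) → Proc ns nd
  caseR   : {m : ℕ} → (Fin m → Proc ns nd) → Proc ns nd
  sendL   : {m : ℕ} → Fin m → Proc ns nd → Proc ns nd
  close   : Proc ns nd
  wait    : Proc ns nd → Proc ns nd
  sendRμ  : Fin ns → Proc ns nd → Proc ns nd
  caseLμ  : Fin ns → Proc ns nd → Proc ns nd
  caseRν  : Fin ns → Proc ns nd → Proc ns nd
  sendLν  : Fin ns → Proc ns nd → Proc ns nd
  call    : Fin nd → Proc ns nd

record ProcDefs (ns nd : ℕ) : Set where
  field
    dctx  : Fin nd → Ctx ns
    dtype : Fin nd → Tp ns
    dbody : Fin nd → Proc ns nd
open ProcDefs public

module _ {ns nd : ℕ} (S : Signature ns) (V : ProcDefs ns nd) where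

  data _⊢_∷_ : Ctx ns → Proc ns nd → Tp ns → Set where
    Id   : ∀ {A} → just A ⊢ fwd ∷ A
    Cut  : ∀ {ω A C P Q} → ω ⊢ P ∷ A → just A ⊢ Q ∷ C → ω ⊢ cut P Q ∷ C
    ⊕R   : ∀ {ω m} {As : Fin m → Tp ns} {P} (k : Fin m) →
           ω ⊢ P ∷ As k → ω ⊢ sendR k P ∷ ⊕⟨ As ⟩
    ⊕L   : ∀ {m} {As : Fin m → Tp ns} {Qs C} →
           (∀ k → just (As k) ⊢ Qs k ∷ C) → just ⊕⟨ As ⟩ ⊢ caseL Qs ∷ C
    &R   : ∀ {ω m} {As : Fin m → Tp ns} {Ps} →
           (∀ k → ω ⊢ Ps k ∷ As k) → ω ⊢ caseR Ps ∷ &⟨ As ⟩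
    &L   : ∀ {m} {As : Fin m → Tp ns} {Q C} (k : Fin m) →
           just (As k) ⊢ Q ∷ C → just &⟨ As ⟩ ⊢ sendL k Q ∷ C
    𝟙R   : nothing ⊢ close ∷ 𝟙
    𝟙L   : ∀ {Q C} → nothing ⊢ Q ∷ C → just 𝟙 ⊢ wait Q ∷ C
    μR   : ∀ {ω t P} → pol S t ≡ μ → ω ⊢ P ∷ body S t → ω ⊢ sendRμ t P ∷ tvar t
    μL   : ∀ {t Q C} → pol S t ≡ μ → just (body S t) ⊢ Q ∷ C →
           just (tvar t) ⊢ caseLμ t Q ∷ C
    νR   : ∀ {ω t P} → pol S t ≡ ν → ω ⊢ P ∷ body S t → ω ⊢ caseRν t P ∷ tvar t
    νL   : ∀ {t Q C} → pol S t ≡ ν → just (body S t) ⊢ Q ∷ C →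
           just (tvar t) ⊢ sendLν t Q ∷ C
    Def  : ∀ X → dctx V X ⊢ call X ∷ dtype V X

  WellTypedDefs : Set
  WellTypedDefs = ∀ X → dctx V X ⊢ dbody V X ∷ dtype V X

  -- Configurations, taken modulo associativity and the unit (·):
  -- a configuration is a list of processes, [] being (·).

  Config : Set
  Config = List (Proc ns nd)

  data _⊩_∷_ : Ctx ns → Config → Tp ns → Set where
    emp  : ∀ {A} → just A ⊩ [] ∷ A
    comp : ∀ {ω P A 𝒞 B} → ω ⊢ P ∷ A → just A ⊩ 𝒞 ∷ B → ω ⊩ (P ∷ 𝒞) ∷ B

  data Red : Config → Config → Set where
    r-fwd   : Red (fwd ∷ []) []
    r-spawn : ∀ {P Q} → Red (cut P Q ∷ []) (P ∷ Q ∷ [])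
    r-⊕     : ∀ {m} {k : Fin m} {P Qs} → Red (sendR k P ∷ caseL Qs ∷ []) (P ∷ Qs k ∷ [])
    r-&     : ∀ {m} {k : Fin m} {Ps Q} → Red (caseR Ps ∷ sendL k Q ∷ []) (Ps k ∷ Q ∷ [])
    r-𝟙     : ∀ {Q} → Red (close ∷ wait Q ∷ []) (Q ∷ [])
    r-μ     : ∀ {t P Q} → Red (sendRμ t P ∷ caseLμ t Q ∷ []) (P ∷ Q ∷ [])
    r-ν     : ∀ {t P Q} → Red (caseRν t P ∷ sendLν t Q ∷ []) (P ∷ Q ∷ [])
    r-call  : ∀ {X} → Red (call X ∷ []) (dbody V X ∷ [])

  data _↦_ : Config → Config → Set where
    step : ∀ (𝒟₁ 𝒟₂ : Config) {𝒞 𝒞′} → Red 𝒞 𝒞′ → (𝒟₁ ++ 𝒞 ++ 𝒟₂) ↦ (𝒟₁ ++ 𝒞′ ++ 𝒟₂)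

  data ReadyLeft : Proc ns nd → Set where
    rl-caseL  : ∀ {m} {Qs : Fin m → Proc ns nd} → ReadyLeft (caseL Qs)
    rl-sendL  : ∀ {m} {k : Fin m} {Q} → ReadyLeft (sendL k Q)
    rl-wait   : ∀ {Q} → ReadyLeft (wait Q)
    rl-caseLμ : ∀ {t Q} → ReadyLeft (caseLμ t Q)
    rl-sendLν : ∀ {t Q} → ReadyLeft (sendLν t Q)

  data ReadyRight : Proc ns nd → Set where
    rr-sendR  : ∀ {m} {k : Fin m} {P} → ReadyRight (sendR k P)
    rr-caseR  : ∀ {m} {Ps : Fin m → Proc ns nd} → ReadyRight (caseR Ps)
    rr-close  : ReadyRight close
    rr-sendRμ : ∀ {t P} → ReadyRight (sendRμ t P)
    rr-caseRν : ∀ {t P} → ReadyRight (caseRν t P)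

  -- Only the leftmost (rightmost) process of a configuration owns its
  -- external left (right) channel.
  AttemptsLeft : Config → Set
  AttemptsLeft 𝒞 = Σ (Proc ns nd) λ P → Σ Config λ 𝒞′ → (𝒞 ≡ P ∷ 𝒞′) × ReadyLeft P

  AttemptsRight : Config → Set
  AttemptsRight 𝒞 = Σ Config λ 𝒞′ → Σ (Proc ns nd) λ P → (𝒞 ≡ 𝒞′ ++ (P ∷ [])) × ReadyRight P

module Submission where

-- A configuration is a chain P₁ | P₂ | … | Pₙ in which neighbouring
-- processes share one channel.  The proof rests on two local facts:
--
--  * classification: a well-typed process either reduces on its own
--    (forward, spawn, call unfolding), or is ready on its left channel,
--    or is ready on its right channel;
--  * handshake: if P is ready on its right channel of type A and the
--    process Q to its right, which uses that channel at type A, is ready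
--    on its left channel, then the pair P | Q reduces — typing forces the
--    two actions to be dual (a μ/ν clash is ruled out by polarity).
--
-- Scanning the chain from the left: if P₁ reduces we are done; if it
-- is ready to the left the configuration attempts to communicate to the
-- left; otherwise it is ready to the right and we move right, stopping
-- at the first process that reduces alone or is ready to the left (then
-- the handshake applies), or at the end of the chain, where the last
-- process attempts to communicate to the right.

open import Defs
open import Data.Nat using (ℕ)
open import Data.List using ([]; _∷_)
open import Data.Sum using (_⊎_; inj₁; inj₂)
open import Data.Product using (∃; _,_)
open import Data.Empty using (⊥; ⊥-elim)
open import Data.Maybe using (just)
open import Relation.Binary.PropositionalEquality using (_≡_; refl; cong)

polarity-clash : ∀ {a : Polarity} → a ≡ μ → a ≡ ν → ⊥
polarity-clash refl ()

module Progress {ns nd : ℕ} (S : Signature ns) (V : ProcDefs ns nd) where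

  CanStep : Config S V → Set
  CanStep 𝒞 = ∃ λ 𝒞′ → _↦_ S V 𝒞 𝒞′

  step-under : ∀ {P 𝒞} → CanStep 𝒞 → CanStep (P ∷ 𝒞)
  step-under {P} (_ , step 𝒟₁ 𝒟₂ r) = _ , step (P ∷ 𝒟₁) 𝒟₂ r

  classify : ∀ {ω P C} → _⊢_∷_ S V ω P C →
    (∃ λ 𝒞′ → Red S V (P ∷ []) 𝒞′) ⊎ ReadyLeft S V P ⊎ ReadyRight S V P
  classify Id       = inj₁ (_ , r-fwd)
  classify (Cut _ _) = inj₁ (_ , r-spawn)
  classify (Def _)  = inj₁ (_ , r-call)
  classify (⊕L _)   = inj₂ (inj₁ rl-caseL)
  classify (&L _ _) = inj₂ (inj₁ rl-sendL)
  classify (𝟙L _)   = inj₂ (inj₁ rl-wait)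
  classify (μL _ _) = inj₂ (inj₁ rl-caseLμ)
  classify (νL _ _) = inj₂ (inj₁ rl-sendLν)
  classify (⊕R _ _) = inj₂ (inj₂ rr-sendR)
  classify (&R _)   = inj₂ (inj₂ rr-caseR)
  classify 𝟙R       = inj₂ (inj₂ rr-close)
  classify (μR _ _) = inj₂ (inj₂ rr-sendRμ)
  classify (νR _ _) = inj₂ (inj₂ rr-caseRν)

  -- In every mismatched case the client's typing is impossible,
  -- except μ against ν on the same type name, excluded by its polarity.
  handshake : ∀ {ω P A Q C} → ReadyRight S V P → ReadyLeft S V Q →
    _⊢_∷_ S V ω P A → _⊢_∷_ S V (just A) Q C →
    ∃ λ 𝒞′ → Red S V (P ∷ Q ∷ []) 𝒞′
  handshake rr-sendR  rl-caseL  (⊕R _ _) (⊕L _)   = _ , r-⊕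
  handshake rr-sendR  rl-sendL  (⊕R _ _) ()
  handshake rr-sendR  rl-wait   (⊕R _ _) ()
  handshake rr-sendR  rl-caseLμ (⊕R _ _) ()
  handshake rr-sendR  rl-sendLν (⊕R _ _) ()
  handshake rr-caseR  rl-caseL  (&R _)   ()
  handshake rr-caseR  rl-sendL  (&R _)   (&L _ _) = _ , r-&
  handshake rr-caseR  rl-wait   (&R _)   ()
  handshake rr-caseR  rl-caseLμ (&R _)   ()
  handshake rr-caseR  rl-sendLν (&R _)   ()
  handshake rr-close  rl-caseL  𝟙R       ()
  handshake rr-close  rl-sendL  𝟙R       ()
  handshake rr-close  rl-wait   𝟙R       (𝟙L _)   = _ , r-𝟙
  handshake rr-close  rl-caseLμ 𝟙R       ()
  handshake rr-close  rl-sendLν 𝟙R       ()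
  handshake rr-sendRμ rl-caseL  (μR _ _) ()
  handshake rr-sendRμ rl-sendL  (μR _ _) ()
  handshake rr-sendRμ rl-wait   (μR _ _) ()
  handshake rr-sendRμ rl-caseLμ (μR _ _) (μL _ _) = _ , r-μ
  handshake rr-sendRμ rl-sendLν (μR p _) (νL q _) = ⊥-elim (polarity-clash p q)
  handshake rr-caseRν rl-caseL  (νR _ _) ()
  handshake rr-caseRν rl-sendL  (νR _ _) ()
  handshake rr-caseRν rl-wait   (νR _ _) ()
  handshake rr-caseRν rl-caseLμ (νR p _) (μL q _) = ⊥-elim (polarity-clash q p)
  handshake rr-caseRν rl-sendLν (νR _ _) (νL _ _) = _ , r-ν

  rightward-progress : ∀ {ω P A 𝒞 B} → ReadyRight S V P →
    _⊢_∷_ S V ω P A → _⊩_∷_ S V (just A) 𝒞 B →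
    CanStep (P ∷ 𝒞) ⊎ AttemptsRight S V (P ∷ 𝒞)
  rightward-progress rr dP emp = inj₂ ([] , _ , refl , rr)
  rightward-progress {P = P} rr dP (comp {𝒞 = 𝒞} dQ d𝒞) with classify dQ
  ... | inj₁ (_ , r)         = inj₁ (_ , step (P ∷ []) 𝒞 r)
  ... | inj₂ (inj₁ rl)       with handshake rr rl dP dQ
  ...   | _ , r              = inj₁ (_ , step [] 𝒞 r)
  rightward-progress {P = P} rr dP (comp dQ d𝒞) | inj₂ (inj₂ rr′)
    with rightward-progress rr′ dQ d𝒞
  ... | inj₁ s               = inj₁ (step-under s)
  ... | inj₂ (𝒞′ , R , eq , rrR) = inj₂ (P ∷ 𝒞′ , R , cong (P ∷_) eq , rrR)

mainTheorem8 : ∀ {ns nd : ℕ} (S : Signature ns) (V : ProcDefs ns nd) →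
    WellTypedDefs S V →
    ∀ {ω 𝒞 A} → _⊩_∷_ S V ω 𝒞 A →
    (∃ λ 𝒞′ → _↦_ S V 𝒞 𝒞′) ⊎ (𝒞 ≡ []) ⊎ AttemptsLeft S V 𝒞 ⊎ AttemptsRight S V 𝒞
mainTheorem8 S V _ emp = inj₂ (inj₁ refl)
mainTheorem8 S V _ (comp {P = P} {𝒞 = 𝒞} dP d𝒞) with Progress.classify S V dP
... | inj₁ (_ , r)   = inj₁ (_ , step [] 𝒞 r)
... | inj₂ (inj₁ rl) = inj₂ (inj₂ (inj₁ (P , 𝒞 , refl , rl)))
... | inj₂ (inj₂ rr) with Progress.rightward-progress S V rr dP d𝒞
...   | inj₁ s = inj₁ s
...   | inj₂ a = inj₂ (inj₂ (inj₂ a))
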